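{- Let $\mathbb{A}=(A,\backslash,\slash)$ be a residuation algebra with no zero-divisors such that $a\backslash(b\vee c)\leq (a\backslash b)\vee(a\backslash c)$ for all $a,b,c\in A$. Then $\mathbb{A}^\delta_+$ is total, i.e. $x\cdot y\in J^\infty(A^\delta)$ for all $x,y\in J^\infty(A^\delta)$.
   Context: A residuation algebra is a structure $\mathbb{A}=(A,\backslash,\slash)$ where $A$ is a bounded distributive lattice and $\backslash,\slash$ are binary operations on $A$ such that $\backslash$ preserves finite (including empty) meets in its second coordinate, $\slash$ preserves finite (including empty) meets in its first coordinate, and for all $a,b,c\in A$: $b\leq a\backslash c$ iff $a\leq c\slash b$. The canonical extension $A^\delta$ of $A$ is the complete lattice containing $A$ as a sublattice which is dense (every element is a join of meets of elements of $A$ and a meet of joins of elements of $A$) and compact (if $S,T\subseteq A$ and $\bigwedge S\le\bigvee T$ then this already holds for some finite $S'\subseteq S,T'\subseteq T$). $K(A^\delta)$ are meets of subsets of $A$; $O(A^\delta)$ are joins of subsets of $A$. The $\pi$-extension of $\backslash$ is $k\backslash^\pi o=\bigvee\{a\backslash b : a,b\in A,\ k\leq a,\ b\leq o\}$ for $k\in K(A^\delta)$, $o\in O(A^\delta)$, and $u\backslash^\pi v=\bigwedge\{k\backslash^\pi o : k\in K(A^\delta),o\in O(A^\delta),k\leq u,\ v\leq o\}$ in general. There is a binary operation $\cdot$ on $A^\delta$ with $u\cdot v\leq w$ iff $v\leq u\backslash^\pi w$ for all $u,v,w\in A^\delta$ (namely $u\cdot v=\bigwedge\{w: v\leq u\backslash^\pi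 w\}$). $J^\infty(A^\delta)$ is the set of completely join-irreducible elements of $A^\delta$. $\mathbb{A}$ has no zero-divisors if $x\cdot y\neq\bot$ for all $x,y\in J^\infty(A^\delta)$. The dual structure $\mathbb{A}^\delta_+=(J^\infty(A^\delta),\geq,R)$ with $R(x,y,z)$ iff $x\leq y\cdot z$ is called total if $y\cdot z\in J^\infty(A^\delta)$ for all $y,z\in J^\infty(A^\delta)$. -}

module Defs where

open import Level using (0ℓ; Lift)
open import Data.Product using (Σ; Σ-syntax; ∃; _×_; _,_)
open import Data.List using (List)
open import Data.List.Membership.Propositional using (_∈_)
open import Data.List.Relation.Unary.All using (All)
open import Relation.Binary.PropositionalEquality using (_≡_)
open import Relation.Binary.Structures using (IsPartialOrder)
open import Relation.Nullary using (¬_)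
open import Data.Empty.Polymorphic using (⊥)

record BDLattice : Set₁ where
  infix  4 _≤_
  infixr 7 _∧_
  infixr 6 _∨_
  field
    Carrier        : Set
    _≤_            : Carrier → Carrier → Set
    isPartialOrder : IsPartialOrder _≡_ _≤_
    _∧_ _∨_        : Carrier → Carrier → Carrier
    ⊤ᴬ ⊥ᴬ          : Carrier
    ∧-lb₁ : ∀ a b → a ∧ b ≤ a
    ∧-lb₂ : ∀ a b → a ∧ b ≤ b
    ∧-glb : ∀ a b c → c ≤ a → c ≤ b → c ≤ a ∧ b
    ∨-ub₁ : ∀ a b → a ≤ a ∨ b
    ∨-ub₂ : ∀ a b → b ≤ a ∨ b
    ∨-lub : ∀ a b c → a ≤ c → b ≤ c → a ∨ b ≤ c
    ⊤-max : ∀ a → a ≤ ⊤ᴬ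
    ⊥-min : ∀ a → ⊥ᴬ ≤ a
    distrib : ∀ a b c → a ∧ (b ∨ c) ≤ (a ∧ b) ∨ (a ∧ c)

record ResiduationAlgebra : Set₁ where
  field
    lattice : BDLattice
  open BDLattice lattice public
  infixr 8 _\\_ _//_
  field
    _\\_ _//_ : Carrier → Carrier → Carrier
    \\-∧ : ∀ a b c → a \\ (b ∧ c) ≡ (a \\ b) ∧ (a \\ c)
    \\-⊤ : ∀ a → a \\ ⊤ᴬ ≡ ⊤ᴬ
    //-∧ : ∀ a b c → (b ∧ c) // a ≡ (b // a) ∧ (c // a)
    //-⊤ : ∀ a → ⊤ᴬ // a ≡ ⊤ᴬ
    resid→ : ∀ a b c → b ≤ a \\ c → a ≤ c // b
    resid← : ∀ a b c → a ≤ c // b → b ≤ a \\ c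

record CompleteLattice : Set₂ where
  infix 4 _⊑_
  field
    C              : Set
    _⊑_            : C → C → Set
    isPartialOrder : IsPartialOrder _≡_ _⊑_
    ⋁ ⋀            : (C → Set₁) → C
    ⋁-ub  : ∀ P u → P u → u ⊑ ⋁ P
    ⋁-lub : ∀ P v → (∀ u → P u → u ⊑ v) → ⋁ P ⊑ v
    ⋀-lb  : ∀ P u → P u → ⋀ P ⊑ u
    ⋀-glb : ∀ P v → (∀ u → P u → v ⊑ u) → v ⊑ ⋀ P

record CanonicalExtension (A : BDLattice) : Set₂ where
  open BDLattice A
  field
    completeLattice : CompleteLattice
  open CompleteLattice completeLattice public
  field
    e       : Carrier → C
    e-mono    : ∀ a b → a ≤ b → e a ⊑ e b
    e-reflect : ∀ a b → e a ⊑ e b → a ≤ b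
    -- e is a bounded lattice homomorphism (A is a bounded sublattice)
    e-∧ : ∀ a b u → u ⊑ e a → u ⊑ e b → u ⊑ e (a ∧ b)
    e-∨ : ∀ a b u → e a ⊑ u → e b ⊑ u → e (a ∨ b) ⊑ u
    e-⊤ : ∀ u → u ⊑ e ⊤ᴬ
    e-⊥ : ∀ u → e ⊥ᴬ ⊑ u

  img : (Carrier → Set) → C → Set₁
  img S c = Lift _ (Σ[ a ∈ Carrier ] (S a × e a ≡ c))

  IsClosed : C → Set₁
  IsClosed u = Σ[ S ∈ (Carrier → Set) ] (u ≡ ⋀ (img S))

  IsOpen : C → Set₁
  IsOpen u = Σ[ S ∈ (Carrier → Set) ] (u ≡ ⋁ (img S))

  listPred : List Carrier → Carrier → Set
  listPred xs a = a ∈ xs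

  field
    dense-K : ∀ u → Σ[ P ∈ (C → Set₁) ] ((∀ k → P k → IsClosed k) × (u ≡ ⋁ P))
    dense-O : ∀ u → Σ[ P ∈ (C → Set₁) ] ((∀ o → P o → IsOpen o) × (u ≡ ⋀ P))
    compact : ∀ (S T : Carrier → Set) → ⋀ (img S) ⊑ ⋁ (img T) →
              Σ[ S' ∈ List Carrier ] Σ[ T' ∈ List Carrier ]
                (All S S' × All T T' ×
                 (⋀ (img (listPred S')) ⊑ ⋁ (img (listPred T'))))

module _ (𝔸 : ResiduationAlgebra) (E : CanonicalExtension (ResiduationAlgebra.lattice 𝔸)) where
  open ResiduationAlgebra 𝔸
  open CanonicalExtension E

  \\πKO : C → C → C
  \\πKO k o = ⋁ (λ c → Lift _ (Σ[ a ∈ Carrier ] Σ[ b ∈ Carrier ]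
                   (k ⊑ e a × e b ⊑ o × c ≡ e (a \\ b))))

  \\π : C → C → C
  \\π u v = ⋀ (λ c → Σ[ k ∈ C ] Σ[ o ∈ C ]
                 (IsClosed k × IsOpen o × k ⊑ u × v ⊑ o × c ≡ \\πKO k o))

  prod : C → C → C
  prod u v = ⋀ (λ w → Lift _ (v ⊑ \\π u w))

  ⊥C : C
  ⊥C = ⋁ (λ _ → ⊥)

  -- completely join-irreducible: whenever x is the join of a set, x is in it
  -- (covers x ≠ ⊥ via the empty set)
  IsCJI : C → Set₂
  IsCJI x = ∀ (S : C → Set₁) → x ≡ ⋁ S → S x

  NoZeroDivisors : Set₂
  NoZeroDivisors = ∀ x y → IsCJI x → IsCJI y → ¬ (prod x y ≡ ⊥C)

  Total : Set₂
  Total = ∀ x y → IsCJI x → IsCJI y → IsCJI (prod x y)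

-- In A^δ every completely join-irreducible element y is closed and join-prime with
-- respect to A. For closed x and y, the product x·y is the closed element cut out by
-- the filter Q = {c | ∃ a ≥ x, d ≥ y. d ≤ a\c} of A. The distributivity hypothesis
-- together with join-primeness of y makes Q prime, absence of zero-divisors makes it
-- proper, and by compactness the closed element of a proper prime filter is
-- completely join-irreducible.
module Submission where

open import Defs
open import Level using (0ℓ; suc; Lift; lift)
open import Axiom.ExcludedMiddle using (ExcludedMiddle)
open import Function using (_∘_)
open import Data.Product using (Σ; Σ-syntax; _×_; _,_)
open import Data.Sum using (_⊎_; inj₁; inj₂; [_,_]′)
open import Data.Empty using (⊥-elim)
open import Data.List using (List; []; _∷_)
open import Data.List.Membership.Propositional using (_∈_)
open import Data.List.Relation.Unary.Any using (here; there)
open import Data.List.Relation.Unary.All using (All; []; _∷_)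
open import Relation.Binary.PropositionalEquality using (_≡_; refl; sym; cong; subst)
open import Relation.Binary.Bundles using (Poset)
open import Relation.Binary.Structures using (IsPartialOrder)
import Relation.Binary.Reasoning.PartialOrder as PosetReasoning
open import Relation.Nullary using (¬_; yes; no)

module LatticeTheory (A : BDLattice) where
  open BDLattice A

  module ≤ = IsPartialOrder isPartialOrder

  poset : Poset 0ℓ 0ℓ 0ℓ
  poset = record { Carrier = Carrier ; _≈_ = _≡_ ; _≤_ = _≤_ ; isPartialOrder = isPartialOrder }

  ∧-mono : ∀ {a a′ b b′} → a ≤ a′ → b ≤ b′ → a ∧ b ≤ a′ ∧ b′
  ∧-mono p q = ∧-glb _ _ _ (≤.trans (∧-lb₁ _ _) p) (≤.trans (∧-lb₂ _ _) q)

  ∨-mono : ∀ {a a′ b b′} → a ≤ a′ → b ≤ b′ → a ∨ b ≤ a′ ∨ b′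
  ∨-mono p q = ∨-lub _ _ _ (≤.trans p (∨-ub₁ _ _)) (≤.trans q (∨-ub₂ _ _))

  ∧-∨-split : ∀ {s₁ s₂ c₁ c₂ a₁ a₂} → s₁ ∧ c₁ ≤ a₁ → s₂ ∧ c₂ ≤ a₂ →
              (s₁ ∧ s₂) ∧ (c₁ ∨ c₂) ≤ a₁ ∨ a₂
  ∧-∨-split p q = ≤.trans (distrib _ _ _)
    (∨-mono (≤.trans (∧-mono (∧-lb₁ _ _) ≤.refl) p) (≤.trans (∧-mono (∧-lb₂ _ _) ≤.refl) q))

  ⋀ᴸ ⋁ᴸ : List Carrier → Carrier
  ⋀ᴸ []      = ⊤ᴬ
  ⋀ᴸ (a ∷ l) = a ∧ ⋀ᴸ l
  ⋁ᴸ []      = ⊥ᴬ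
  ⋁ᴸ (a ∷ l) = a ∨ ⋁ᴸ l

  ⋀ᴸ-lb : ∀ {a l} → a ∈ l → ⋀ᴸ l ≤ a
  ⋀ᴸ-lb (here refl) = ∧-lb₁ _ _
  ⋀ᴸ-lb (there a∈l) = ≤.trans (∧-lb₂ _ _) (⋀ᴸ-lb a∈l)

  ⋁ᴸ-ub : ∀ {a l} → a ∈ l → a ≤ ⋁ᴸ l
  ⋁ᴸ-ub (here refl) = ∨-ub₁ _ _
  ⋁ᴸ-ub (there a∈l) = ≤.trans (⋁ᴸ-ub a∈l) (∨-ub₂ _ _)

  record IsFilter (F : Carrier → Set) : Set where
    field
      upward   : ∀ {a b} → a ≤ b → F a → F b
      ⊤∈       : F ⊤ᴬ
      ∧-closed : ∀ {a b} → F a → F b → F (a ∧ b)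

    ⋀ᴸ∈ : ∀ {l} → All F l → F (⋀ᴸ l)
    ⋀ᴸ∈ []       = ⊤∈
    ⋀ᴸ∈ (p ∷ ps) = ∧-closed p (⋀ᴸ∈ ps)

  record IsIdeal (I : Carrier → Set) : Set where
    field
      downward : ∀ {a b} → a ≤ b → I b → I a
      ⊥∈       : I ⊥ᴬ
      ∨-closed : ∀ {a b} → I a → I b → I (a ∨ b)

    ⋁ᴸ∈ : ∀ {l} → All I l → I (⋁ᴸ l)
    ⋁ᴸ∈ []       = ⊥∈
    ⋁ᴸ∈ (p ∷ ps) = ∨-closed p (⋁ᴸ∈ ps)

  record IsPrimeFilter (F : Carrier → Set) : Set where
    field
      isFilter : IsFilter F
      ⊥∉       : ¬ F ⊥ᴬ
      ∨-prime  : ∀ {a b} → F (a ∨ b) → F a ⊎ F b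

    open IsFilter isFilter public

  complement-isIdeal : ∀ {F} → IsPrimeFilter F → IsIdeal (¬_ ∘ F)
  complement-isIdeal F-prime = record
    { downward = λ a≤b ¬Fb Fa → ¬Fb (upward a≤b Fa)
    ; ⊥∈       = ⊥∉
    ; ∨-closed = λ ¬Fa ¬Fb Fa∨b → [ ¬Fa , ¬Fb ]′ (∨-prime Fa∨b)
    }
    where
    open IsPrimeFilter F-prime

  extend : (Carrier → Set) → Carrier → Carrier → Set
  extend F c b = Σ[ s ∈ Carrier ] (F s × s ∧ c ≤ b)

  extend-isFilter : ∀ {F} → IsFilter F → ∀ c → IsFilter (extend F c)
  extend-isFilter F-filter c = record
    { upward   = λ { a≤b (s , Fs , s∧c≤a) → s , Fs , ≤.trans s∧c≤a a≤b }
    ; ⊤∈       = ⊤ᴬ , ⊤∈ , ⊤-max _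
    ; ∧-closed = λ { (s₁ , Fs₁ , p₁) (s₂ , Fs₂ , p₂) →
        s₁ ∧ s₂ , ∧-closed Fs₁ Fs₂ ,
        ∧-glb _ _ _ (≤.trans (∧-mono (∧-lb₁ _ _) ≤.refl) p₁)
                    (≤.trans (∧-mono (∧-lb₂ _ _) ≤.refl) p₂) }
    }
    where open IsFilter F-filter

module ExtensionTheory {A : BDLattice} (E : CanonicalExtension A) where
  open BDLattice A hiding (isPartialOrder)
  open LatticeTheory A
  open CanonicalExtension E hiding (isPartialOrder)

  module ⊑ = IsPartialOrder (CanonicalExtension.isPartialOrder E)

  CompletelyJoinIrreducible : C → Set₂
  CompletelyJoinIrreducible x = ∀ (S : C → Set₁) → x ≡ ⋁ S → S x

  filterOf idealOf : C → Carrier → Set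
  filterOf u a = u ⊑ e a
  idealOf  u b = e b ⊑ u

  filterOf-isFilter : ∀ u → IsFilter (filterOf u)
  filterOf-isFilter u = record
    { upward   = λ a≤b u⊑a → ⊑.trans u⊑a (e-mono _ _ a≤b)
    ; ⊤∈       = e-⊤ u
    ; ∧-closed = e-∧ _ _ u
    }

  idealOf-isIdeal : ∀ u → IsIdeal (idealOf u)
  idealOf-isIdeal u = record
    { downward = λ a≤b b⊑u → ⊑.trans (e-mono _ _ a≤b) b⊑u
    ; ⊥∈       = e-⊥ u
    ; ∨-closed = e-∨ _ _ u
    }

  ⋀-filterOf-⊑ : ∀ {k} → IsClosed k → ⋀ (img (filterOf k)) ⊑ k
  ⋀-filterOf-⊑ (S , refl) = ⋀-glb _ _ λ
    { _ (lift (a , a∈S , refl)) → ⋀-lb _ _ (lift (a , ⋀-lb _ _ (lift (a , a∈S , refl)) , refl)) }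

  ⊑-⋁-idealOf : ∀ {o} → IsOpen o → o ⊑ ⋁ (img (idealOf o))
  ⊑-⋁-idealOf (T , refl) = ⋁-lub _ _ λ
    { _ (lift (b , b∈T , refl)) → ⋁-ub _ _ (lift (b , ⋁-ub _ _ (lift (b , b∈T , refl)) , refl)) }

  ⊑-by-closed : ∀ {u v} → (∀ k → IsClosed k → k ⊑ u → k ⊑ v) → u ⊑ v
  ⊑-by-closed {u} below with dense-K u
  ... | P , P-closed , refl = ⋁-lub _ _ λ k Pk → below k (P-closed k Pk) (⋁-ub _ _ Pk)

  ⊑-by-open : ∀ {u v} → (∀ o → IsOpen o → v ⊑ o → u ⊑ o) → u ⊑ v
  ⊑-by-open {v = v} above with dense-O v
  ... | P , P-open , refl = ⋀-glb _ _ λ o Po → above o (P-open o Po) (⋀-lb _ _ Po)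

  CJI-isClosed : ∀ {x} → CompletelyJoinIrreducible x → IsClosed x
  CJI-isClosed {x} x-cji with dense-K x
  ... | P , P-closed , x≡⋁P = P-closed x (x-cji P x≡⋁P)

  e-⋀ᴸ-⊑ : ∀ l → e (⋀ᴸ l) ⊑ ⋀ (img (listPred l))
  e-⋀ᴸ-⊑ l = ⋀-glb _ _ λ { _ (lift (a , a∈l , refl)) → e-mono _ _ (⋀ᴸ-lb a∈l) }

  ⋁-⊑-e-⋁ᴸ : ∀ l → ⋁ (img (listPred l)) ⊑ e (⋁ᴸ l)
  ⋁-⊑-e-⋁ᴸ l = ⋁-lub _ _ λ { _ (lift (a , a∈l , refl)) → e-mono _ _ (⋁ᴸ-ub a∈l) }

  filter-ideal-meet : ∀ {F I} → IsFilter F → IsIdeal I →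
                      ⋀ (img F) ⊑ ⋁ (img I) → Σ[ a ∈ Carrier ] (F a × I a)
  filter-ideal-meet {F} {I} F-filter I-ideal ⋀F⊑⋁I with compact F I ⋀F⊑⋁I
  ... | l , m , l⊆F , m⊆I , ⋀l⊑⋁m =
    ⋁ᴸ m , IsFilter.upward F-filter ⋀l≤⋁m (IsFilter.⋀ᴸ∈ F-filter l⊆F) , IsIdeal.⋁ᴸ∈ I-ideal m⊆I
    where
    ⋀l≤⋁m : ⋀ᴸ l ≤ ⋁ᴸ m
    ⋀l≤⋁m = e-reflect _ _ (⊑.trans (e-⋀ᴸ-⊑ l) (⊑.trans ⋀l⊑⋁m (⋁-⊑-e-⋁ᴸ m)))

  module _ {y} (y-cji : CompletelyJoinIrreducible y) where
    private
      k : Carrier → C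
      k c = ⋀ (img (extend (filterOf y) c))

      k⊑e : ∀ c → k c ⊑ e c
      k⊑e c = ⋀-lb _ _ (lift (c , (⊤ᴬ , e-⊤ y , ∧-lb₂ _ _) , refl))

      k⊑y : ∀ c → k c ⊑ y
      k⊑y c = ⊑.trans
        (⋀-glb _ _ λ { _ (lift (a , y⊑a , refl)) → ⋀-lb _ _ (lift (a , (a , y⊑a , ∧-lb₁ _ _) , refl)) })
        (⋀-filterOf-⊑ (CJI-isClosed y-cji))

      separate : ∀ {o} c → IsOpen o → k c ⊑ o →
                 Σ[ a ∈ Carrier ] (extend (filterOf y) c a × e a ⊑ o)
      separate c o-open kc⊑o =
        filter-ideal-meet (extend-isFilter (filterOf-isFilter y) c) (idealOf-isIdeal _)
                          (⊑.trans kc⊑o (⊑-⋁-idealOf o-open))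

    -- y = k c₁ ∨ k c₂ where k c is the closed element y ∧ c; this is where
    -- distributivity of A enters, through compactness.
    CJI-joinPrime : ∀ {c₁ c₂} → y ⊑ e (c₁ ∨ c₂) → y ⊑ e c₁ ⊎ y ⊑ e c₂
    CJI-joinPrime {c₁} {c₂} y⊑c₁∨c₂ with y-cji pair (⊑.antisym y⊑⋁pair ⋁pair⊑y)
      where
      pair : C → Set₁
      pair u = Lift _ (u ≡ k c₁ ⊎ u ≡ k c₂)

      ⋁pair⊑y : ⋁ pair ⊑ y
      ⋁pair⊑y = ⋁-lub _ _ λ { _ (lift (inj₁ refl)) → k⊑y c₁ ; _ (lift (inj₂ refl)) → k⊑y c₂ }

      below-opens : ∀ o → IsOpen o → ⋁ pair ⊑ o → y ⊑ o
      below-opens o o-open ⋁pair⊑o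
        with separate c₁ o-open (⊑.trans (⋁-ub _ _ (lift (inj₁ refl))) ⋁pair⊑o)
           | separate c₂ o-open (⊑.trans (⋁-ub _ _ (lift (inj₂ refl))) ⋁pair⊑o)
      ... | a₁ , (s₁ , y⊑s₁ , s₁∧c₁≤a₁) , a₁⊑o | a₂ , (s₂ , y⊑s₂ , s₂∧c₂≤a₂) , a₂⊑o =
        ⊑.trans (e-∧ _ _ _ (e-∧ _ _ _ y⊑s₁ y⊑s₂) y⊑c₁∨c₂)
          (⊑.trans (e-mono _ _ (∧-∨-split s₁∧c₁≤a₁ s₂∧c₂≤a₂)) (e-∨ _ _ _ a₁⊑o a₂⊑o))

      y⊑⋁pair : y ⊑ ⋁ pair
      y⊑⋁pair = ⊑-by-open below-opens
    ... | lift (inj₁ y≡k₁) = inj₁ (subst (_⊑ e c₁) (sym y≡k₁) (k⊑e c₁))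
    ... | lift (inj₂ y≡k₂) = inj₂ (subst (_⊑ e c₂) (sym y≡k₂) (k⊑e c₂))

  module _ (em : ExcludedMiddle (suc 0ℓ)) where
    ⋀-⊑-or-escapes : ∀ {F c} → IsClosed c →
                     ⋀ (img F) ⊑ c ⊎ Σ[ q ∈ Carrier ] (c ⊑ e q × ¬ F q)
    ⋀-⊑-or-escapes {F} (S , refl) with em {Lift _ (Σ[ q ∈ Carrier ] (S q × ¬ F q))}
    ... | yes (lift (q , Sq , ¬Fq)) = inj₂ (q , ⋀-lb _ _ (lift (q , Sq , refl)) , ¬Fq)
    ... | no none = inj₁ (⋀-glb _ _ λ { _ (lift (q , Sq , refl)) → ⋀-lb _ _ (lift (q , in-F q Sq , refl)) })
      where
      in-F : ∀ q → S q → F q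
      in-F q Sq with em {Lift _ (F q)}
      ... | yes (lift Fq) = Fq
      ... | no ¬Fq = ⊥-elim (none (lift (q , Sq , λ Fq → ¬Fq (lift Fq))))

    ⋀-⊑-⋁-complement : ∀ {F S} → ¬ S (⋀ (img F)) → ⋀ (img F) ≡ ⋁ S →
                       ⋀ (img F) ⊑ ⋁ (img (¬_ ∘ F))
    ⋀-⊑-⋁-complement {F} {S} ¬S⋀F ⋀F≡⋁S =
      subst (_⊑ ⋁ (img (¬_ ∘ F))) (sym ⋀F≡⋁S) (⋁-lub _ _ λ s Ss → ⊑-by-closed (escape s Ss))
      where
      escape : ∀ s → S s → ∀ c → IsClosed c → c ⊑ s → c ⊑ ⋁ (img (¬_ ∘ F))
      escape s Ss c c-closed c⊑s with ⋀-⊑-or-escapes c-closed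
      ... | inj₂ (q , c⊑q , ¬Fq) = ⊑.trans c⊑q (⋁-ub _ _ (lift (q , ¬Fq , refl)))
      ... | inj₁ ⋀F⊑c = ⊥-elim (¬S⋀F (subst S (⊑.antisym s⊑⋀F (⊑.trans ⋀F⊑c c⊑s)) Ss))
        where
        s⊑⋀F : s ⊑ ⋀ (img F)
        s⊑⋀F = subst (s ⊑_) (sym ⋀F≡⋁S) (⋁-ub _ _ Ss)

    primeFilter-CJI : ∀ {F} → IsPrimeFilter F → CompletelyJoinIrreducible (⋀ (img F))
    primeFilter-CJI {F} F-prime S ⋀F≡⋁S with em {S (⋀ (img F))}
    ... | yes S⋀F = S⋀F
    ... | no ¬S⋀F
      with filter-ideal-meet (IsPrimeFilter.isFilter F-prime) (complement-isIdeal F-prime)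
                             (⋀-⊑-⋁-complement ¬S⋀F ⋀F≡⋁S)
    ... | _ , Fa , ¬Fa = ⊥-elim (¬Fa Fa)

module ResiduationTheory (𝔸 : ResiduationAlgebra)
                         (E : CanonicalExtension (ResiduationAlgebra.lattice 𝔸)) where
  open ResiduationAlgebra 𝔸 hiding (isPartialOrder)
  open LatticeTheory lattice
  open ExtensionTheory E
  open CanonicalExtension E hiding (isPartialOrder)
  open PosetReasoning poset

  \\-monoʳ : ∀ {a b c} → b ≤ c → a \\ b ≤ a \\ c
  \\-monoʳ {a} {b} {c} b≤c = begin
    a \\ b            ≡⟨ cong (a \\_) (sym b∧c≡b) ⟩
    a \\ (b ∧ c)      ≡⟨ \\-∧ a b c ⟩
    a \\ b ∧ a \\ c  ≤⟨ ∧-lb₂ _ _ ⟩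
    a \\ c            ∎
    where
    b∧c≡b : b ∧ c ≡ b
    b∧c≡b = ≤.antisym (∧-lb₁ b c) (∧-glb b c b ≤.refl b≤c)

  \\-antiˡ : ∀ {a a′ c} → a ≤ a′ → a′ \\ c ≤ a \\ c
  \\-antiˡ a≤a′ = resid← _ _ _ (≤.trans a≤a′ (resid→ _ _ _ ≤.refl))

  \\-mono : ∀ {a a′ b b′} → a′ ≤ a → b ≤ b′ → a \\ b ≤ a′ \\ b′
  \\-mono a′≤a b≤b′ = ≤.trans (\\-antiˡ a′≤a) (\\-monoʳ b≤b′)

  divisionIdeal : C → C → Carrier → Set
  divisionIdeal x o d = Σ[ a ∈ Carrier ] Σ[ b ∈ Carrier ] (x ⊑ e a × e b ⊑ o × d ≤ a \\ b)

  divisionIdeal-isIdeal : ∀ x o → IsIdeal (divisionIdeal x o)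
  divisionIdeal-isIdeal x o = record
    { downward = λ { d≤d′ (a , b , x⊑a , b⊑o , d′≤) → a , b , x⊑a , b⊑o , ≤.trans d≤d′ d′≤ }
    ; ⊥∈       = ⊤ᴬ , ⊥ᴬ , e-⊤ x , e-⊥ o , ⊥-min _
    ; ∨-closed = λ { (a₁ , b₁ , x⊑a₁ , b₁⊑o , d₁≤) (a₂ , b₂ , x⊑a₂ , b₂⊑o , d₂≤) →
        a₁ ∧ a₂ , b₁ ∨ b₂ , e-∧ _ _ _ x⊑a₁ x⊑a₂ , e-∨ _ _ _ b₁⊑o b₂⊑o ,
        ∨-lub _ _ _ (≤.trans d₁≤ (\\-mono (∧-lb₁ _ _) (∨-ub₁ _ _)))
                    (≤.trans d₂≤ (\\-mono (∧-lb₂ _ _) (∨-ub₂ _ _))) }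
    }

  \\πKO-⊑-⋁-divisionIdeal : ∀ x o → \\πKO 𝔸 E x o ⊑ ⋁ (img (divisionIdeal x o))
  \\πKO-⊑-⋁-divisionIdeal x o = ⋁-lub _ _ λ
    { _ (lift (a , b , x⊑a , b⊑o , refl)) → ⋁-ub _ _ (lift (a \\ b , (a , b , x⊑a , b⊑o , ≤.refl) , refl)) }

  productFilter : C → C → Carrier → Set
  productFilter x y c = Σ[ a ∈ Carrier ] Σ[ d ∈ Carrier ] (x ⊑ e a × y ⊑ e d × d ≤ a \\ c)

  productFilter-isFilter : ∀ x y → IsFilter (productFilter x y)
  productFilter-isFilter x y = record
    { upward   = λ { c≤c′ (a , d , x⊑a , y⊑d , d≤) → a , d , x⊑a , y⊑d , ≤.trans d≤ (\\-monoʳ c≤c′) }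
    ; ⊤∈       = ⊤ᴬ , ⊤ᴬ , e-⊤ x , e-⊤ y , subst (⊤ᴬ ≤_) (sym (\\-⊤ ⊤ᴬ)) (⊤-max _)
    ; ∧-closed = λ { (a₁ , d₁ , x⊑a₁ , y⊑d₁ , d₁≤) (a₂ , d₂ , x⊑a₂ , y⊑d₂ , d₂≤) →
        a₁ ∧ a₂ , d₁ ∧ d₂ , e-∧ _ _ _ x⊑a₁ x⊑a₂ , e-∧ _ _ _ y⊑d₁ y⊑d₂ ,
        subst (d₁ ∧ d₂ ≤_) (sym (\\-∧ _ _ _))
          (∧-mono (≤.trans d₁≤ (\\-antiˡ (∧-lb₁ _ _))) (≤.trans d₂≤ (\\-antiˡ (∧-lb₂ _ _)))) }
    }

  prod-⊑-productFilter : ∀ {x y c} → productFilter x y c → prod 𝔸 E x y ⊑ e c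
  prod-⊑-productFilter {x} {y} {c} (a , d , x⊑a , y⊑d , d≤a\\c) = ⋀-lb _ _ (lift y⊑x\\c)
    where
    y⊑x\\c : y ⊑ \\π 𝔸 E x (e c)
    y⊑x\\c = ⋀-glb _ _ λ
      { _ (k , o , _ , _ , k⊑x , c⊑o , refl) →
          ⊑.trans y⊑d (⊑.trans (e-mono _ _ d≤a\\c)
            (⋁-ub _ _ (lift (a , c , ⊑.trans k⊑x x⊑a , c⊑o , refl)))) }

  ⋀-productFilter-⊑-prod : ∀ {x y} → IsClosed x → IsClosed y →
                           ⋀ (img (productFilter x y)) ⊑ prod 𝔸 E x y
  ⋀-productFilter-⊑-prod {x} {y} x-closed y-closed = ⋀-glb _ _ λ w (lift y⊑x\\w) →
    ⊑-by-open (below-opens w y⊑x\\w)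
    where
    below-opens : ∀ w → y ⊑ \\π 𝔸 E x w → ∀ o → IsOpen o → w ⊑ o → ⋀ (img (productFilter x y)) ⊑ o
    below-opens w y⊑x\\w o o-open w⊑o
      with filter-ideal-meet (filterOf-isFilter y) (divisionIdeal-isIdeal x o)
             (⊑.trans (⋀-filterOf-⊑ y-closed)
               (⊑.trans (⊑.trans y⊑x\\w (⋀-lb _ _ (x , o , x-closed , o-open , ⊑.refl , w⊑o , refl)))
                        (\\πKO-⊑-⋁-divisionIdeal x o)))
    ... | d , y⊑d , a , b , x⊑a , b⊑o , d≤a\\b =
      ⊑.trans (⋀-lb _ _ (lift (b , (a , d , x⊑a , y⊑d , d≤a\\b) , refl))) b⊑o

  prod-≡-⋀-productFilter : ∀ {x y} → IsClosed x → IsClosed y →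
                           prod 𝔸 E x y ≡ ⋀ (img (productFilter x y))
  prod-≡-⋀-productFilter x-closed y-closed = ⊑.antisym
    (⋀-glb _ _ λ { _ (lift (c , Qc , refl)) → prod-⊑-productFilter Qc })
    (⋀-productFilter-⊑-prod x-closed y-closed)

  productFilter-isPrimeFilter : ∀ {x y} → ¬ prod 𝔸 E x y ≡ ⊥C 𝔸 E →
    (∀ a b c → a \\ (b ∨ c) ≤ a \\ b ∨ a \\ c) →
    CompletelyJoinIrreducible y → IsPrimeFilter (productFilter x y)
  productFilter-isPrimeFilter {x} {y} xy≢⊥ \\-∨ y-cji = record
    { isFilter = productFilter-isFilter x y
    ; ⊥∉       = λ Q⊥ → xy≢⊥ (⊑.antisym (⊑.trans (prod-⊑-productFilter Q⊥) (e-⊥ _)) (⋁-lub _ _ λ _ ()))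
    ; ∨-prime  = prime
    }
    where
    prime : ∀ {c₁ c₂} → productFilter x y (c₁ ∨ c₂) → productFilter x y c₁ ⊎ productFilter x y c₂
    prime {c₁} {c₂} (a , d , x⊑a , y⊑d , d≤)
      with CJI-joinPrime y-cji (⊑.trans y⊑d (e-mono _ _ (≤.trans d≤ (\\-∨ a c₁ c₂))))
    ... | inj₁ y⊑a\\c₁ = inj₁ (a , a \\ c₁ , x⊑a , y⊑a\\c₁ , ≤.refl)
    ... | inj₂ y⊑a\\c₂ = inj₂ (a , a \\ c₂ , x⊑a , y⊑a\\c₂ , ≤.refl)

corollary2p6 : ExcludedMiddle (suc 0ℓ) →
    (𝔸 : ResiduationAlgebra) →
    (E : CanonicalExtension (ResiduationAlgebra.lattice 𝔸)) →
    NoZeroDivisors 𝔸 E →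
    (∀ a b c → ResiduationAlgebra._≤_ 𝔸
                 (ResiduationAlgebra._\\_ 𝔸 a (ResiduationAlgebra._∨_ 𝔸 b c))
                 (ResiduationAlgebra._∨_ 𝔸 (ResiduationAlgebra._\\_ 𝔸 a b)
                                           (ResiduationAlgebra._\\_ 𝔸 a c))) →
    Total 𝔸 E
corollary2p6 em 𝔸 E no-zero-divisors \\-∨ x y x-cji y-cji =
  subst (IsCJI 𝔸 E) (sym (prod-≡-⋀-productFilter (CJI-isClosed x-cji) (CJI-isClosed y-cji)))
    (primeFilter-CJI em (productFilter-isPrimeFilter (no-zero-divisors x y x-cji y-cji) \\-∨ y-cji))
  where
  open ResiduationTheory 𝔸 E
  open ExtensionTheory E
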